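{- (a) In any $*$-continuous BiKAT $\ddot{\mathbb A}$ over a KAT $\mathbb A$, for all tests $e,e'\in\mathbb B$, actions $c,c'\in\mathbb A$ and bitests $Q,R\in\ddot{\mathbb B}$: \[ \langle e;c]^*;\langle\neg e];[e';c'\rangle^*;[\neg e'\rangle = \big(Q;\langle e;c] + R;[e';c'\rangle + \neg Q;\neg R;\langle e;c\mid e';c'\rangle + \neg Q;\langle e;c\mid\neg e'\rangle + \neg R;\langle\neg e\mid e';c'\rangle\big)^*;\langle\neg e\mid\neg e'\rangle. \quad(\ast) \] (b) Let $\ddot{\mathbb A}$ be a BiKAT satisfying $(\ast)$ (for all $e,e',c,c',Q,R$ as in (a)). Writing $c\mid c':P\approx>S$ for $P;\langle c\mid c'\rangle;\neg S=0$, the following rule is sound: for tests $e,e'$, actions $c,c'$ and bitests $P,Q,R$, if $c\mid c': P;\langle e\mid e'\rangle;\neg Q;\neg R\approx> P$, $\;c\mid 1: P;Q;\langle e]\approx> P$, $\;1\mid c': P;R;[e'\rangle\approx> P$, and $P\le \langle e\mid e'\rangle+\langle\neg e\mid\neg e'\rangle + Q;\langle e] + R;[e'\rangle$, then $(e;c)^*;\neg e\mid (e';c')^*;\neg e' : P\approx> P;\langle\neg e\mid\neg e'\rangle$.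
   Context: A KAT $(\mathbb A,\mathbb B,+,;,{}^*,\neg,1,0)$ is a Kleene algebra with a Boolean subalgebra $\mathbb B$ of tests; $a\le b$ iff $a+b=b$. A BiKAT over $\mathbb A$ is a KAT $(\ddot{\mathbb A},\ddot{\mathbb B},\dots)$ with KAT homomorphisms $\langle\cdot\,],[\,\cdot\rangle:\mathbb A\to\ddot{\mathbb A}$ (preserving $0,1,+,;,{}^*$, tests and test negation) such that $\langle x];[y\rangle=[y\rangle;\langle x]$ for all $x,y$; $\langle a\mid b\rangle:=\langle a];[b\rangle$; elements of $\ddot{\mathbb B}$ are bitests. A KAT is $*$-continuous if for all $x,y,z$, $x;y^*;z$ is the supremum of $\{x;y^n;z:n\in\mathbb N\}$ ($y^0=1$, $y^{n+1}=y;y^n$); a BiKAT is $*$-continuous if it and its underlying KAT are. -}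

module Defs where

open import Level using (Level; _⊔_) renaming (suc to lsuc)
open import Data.Nat using (ℕ; zero; suc)
open import Relation.Binary.PropositionalEquality using (_≡_)
open import Data.Product using (_×_)


-- The test subalgebra 𝔹 is given as a
-- predicate on the carrier; test negation ¬ is a total operation whose
-- behaviour is only constrained (and only used) on tests.

record KAT (c : Level) : Set (lsuc c) where
  infixl 6 _+_
  infixl 7 _·_
  infix  8 _*
  infix  9 ¬_
  infix  4 _≤_
  field
    Carrier : Set c
    _+_     : Carrier → Carrier → Carrier
    _·_     : Carrier → Carrier → Carrier
    _*      : Carrier → Carrier
    ¬_      : Carrier → Carrier
    0#      : Carrier
    1#      : Carrier
    𝔹       : Carrier → Set c

  _≤_ : Carrier → Carrier → Set c
  x ≤ y = x + y ≡ y

  field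
    +-assoc   : ∀ x y z → (x + y) + z ≡ x + (y + z)
    +-comm    : ∀ x y → x + y ≡ y + x
    +-idem    : ∀ x → x + x ≡ x
    +-identityˡ : ∀ x → 0# + x ≡ x
    ·-assoc   : ∀ x y z → (x · y) · z ≡ x · (y · z)
    ·-identityˡ : ∀ x → 1# · x ≡ x
    ·-identityʳ : ∀ x → x · 1# ≡ x
    distribˡ  : ∀ x y z → x · (y + z) ≡ x · y + x · z
    distribʳ  : ∀ x y z → (y + z) · x ≡ y · x + z · x
    zeroˡ     : ∀ x → 0# · x ≡ 0#
    zeroʳ     : ∀ x → x · 0# ≡ 0#
    *-unfoldˡ : ∀ x → 1# + x · x * ≤ x *
    *-unfoldʳ : ∀ x → 1# + x * · x ≤ x *
    *-indˡ    : ∀ x y z → z + x · y ≤ y → x * · z ≤ y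
    *-indʳ    : ∀ x y z → z + y · x ≤ y → z · x * ≤ y
    𝔹-0       : 𝔹 0#
    𝔹-1       : 𝔹 1#
    𝔹-+       : ∀ {a b} → 𝔹 a → 𝔹 b → 𝔹 (a + b)
    𝔹-·       : ∀ {a b} → 𝔹 a → 𝔹 b → 𝔹 (a · b)
    𝔹-¬       : ∀ {a} → 𝔹 a → 𝔹 (¬ a)
    𝔹-·-comm  : ∀ {a b} → 𝔹 a → 𝔹 b → a · b ≡ b · a
    𝔹-absorb₁ : ∀ {a b} → 𝔹 a → 𝔹 b → a + a · b ≡ a
    𝔹-absorb₂ : ∀ {a b} → 𝔹 a → 𝔹 b → a · (a + b) ≡ a
    𝔹-distrib : ∀ {a b c} → 𝔹 a → 𝔹 b → 𝔹 c → a + b · c ≡ (a + b) · (a + c)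
    𝔹-compl₁  : ∀ {a} → 𝔹 a → a + ¬ a ≡ 1#
    𝔹-compl₂  : ∀ {a} → 𝔹 a → a · ¬ a ≡ 0#

  _^_ : Carrier → ℕ → Carrier
  y ^ zero  = 1#
  y ^ suc n = y · (y ^ n)

StarContinuous : ∀ {c} → KAT c → Set c
StarContinuous K =
  (x y z : Carrier) →
    ((n : ℕ) → x · (y ^ n) · z ≤ x · y * · z)
    × ((w : Carrier) → ((n : ℕ) → x · (y ^ n) · z ≤ w) → x · y * · z ≤ w)
  where open KAT K

record IsKATHom {c} (𝔸 𝔸' : KAT c) (h : KAT.Carrier 𝔸 → KAT.Carrier 𝔸') : Set c where
  private
    module A = KAT 𝔸
    module B = KAT 𝔸'
  field
    hom-0 : h A.0# ≡ B.0#
    hom-1 : h A.1# ≡ B.1#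
    hom-+ : ∀ x y → h (x A.+ y) ≡ h x B.+ h y
    hom-· : ∀ x y → h (x A.· y) ≡ h x B.· h y
    hom-* : ∀ x → h (x A.*) ≡ (h x) B.*
    hom-𝔹 : ∀ {a} → A.𝔹 a → B.𝔹 (h a)
    hom-¬ : ∀ {a} → A.𝔹 a → h (A.¬ a) ≡ B.¬ (h a)

record BiKAT {c} (𝔸 : KAT c) : Set (lsuc c) where
  field
    Ä      : KAT c
    ⟨_]    : KAT.Carrier 𝔸 → KAT.Carrier Ä
    [_⟩    : KAT.Carrier 𝔸 → KAT.Carrier Ä
    ⟨]-hom : IsKATHom 𝔸 Ä ⟨_]
    [⟩-hom : IsKATHom 𝔸 Ä [_⟩
    ⟨]-[⟩-comm : ∀ x y → KAT._·_ Ä ⟨ x ] [ y ⟩ ≡ KAT._·_ Ä [ y ⟩ ⟨ x ]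

  infixl 6 _⊕_
  infixl 7 _⨾_
  infix  9 ∼_
  infix  4 _≤̈_
  infix  8 _⊛
  infix  3 _∣_∶_≈>_

  Ä-Carrier : Set c
  Ä-Carrier = KAT.Carrier Ä

  _⊕_ : Ä-Carrier → Ä-Carrier → Ä-Carrier
  _⊕_ = KAT._+_ Ä

  _⨾_ : Ä-Carrier → Ä-Carrier → Ä-Carrier
  _⨾_ = KAT._·_ Ä

  _⊛ : Ä-Carrier → Ä-Carrier
  _⊛ = KAT._* Ä

  ∼_ : Ä-Carrier → Ä-Carrier
  ∼_ = KAT.¬_ Ä

  𝟘 : Ä-Carrier
  𝟘 = KAT.0# Ä

  _≤̈_ : Ä-Carrier → Ä-Carrier → Set c
  _≤̈_ = KAT._≤_ Ä

  𝔹̈ : Ä-Carrier → Set c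
  𝔹̈ = KAT.𝔹 Ä

  ⟨_∣_⟩ : KAT.Carrier 𝔸 → KAT.Carrier 𝔸 → Ä-Carrier
  ⟨ a ∣ b ⟩ = ⟨ a ] ⨾ [ b ⟩

  _∣_∶_≈>_ : KAT.Carrier 𝔸 → KAT.Carrier 𝔸 → Ä-Carrier → Ä-Carrier → Set c
  c₁ ∣ c₂ ∶ P ≈> S = P ⨾ ⟨ c₁ ∣ c₂ ⟩ ⨾ ∼ S ≡ 𝟘

StarContinuousBiKAT : ∀ {c} {𝔸 : KAT c} → BiKAT 𝔸 → Set c
StarContinuousBiKAT {𝔸 = 𝔸} D = StarContinuous (BiKAT.Ä D) × StarContinuous 𝔸

StarIdentity : ∀ {c} {𝔸 : KAT c} → (D : BiKAT 𝔸) →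
               (e e' c₁ c₂ : KAT.Carrier 𝔸) (Q R : KAT.Carrier (BiKAT.Ä D)) → Set c
StarIdentity {𝔸 = 𝔸} D e e' c₁ c₂ Q R =
  ⟨ e · c₁ ] ⊛ ⨾ ⟨ ¬ e ] ⨾ [ e' · c₂ ⟩ ⊛ ⨾ [ ¬ e' ⟩
  ≡ ( Q ⨾ ⟨ e · c₁ ] ⊕ R ⨾ [ e' · c₂ ⟩
      ⊕ ∼ Q ⨾ ∼ R ⨾ ⟨ e · c₁ ∣ e' · c₂ ⟩
      ⊕ ∼ Q ⨾ ⟨ e · c₁ ∣ ¬ e' ⟩
      ⊕ ∼ R ⨾ ⟨ ¬ e ∣ e' · c₂ ⟩ ) ⊛ ⨾ ⟨ ¬ e ∣ ¬ e' ⟩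
  where open KAT 𝔸
        open BiKAT D

SatisfiesStar : ∀ {c} {𝔸 : KAT c} → BiKAT 𝔸 → Set c
SatisfiesStar {𝔸 = 𝔸} D =
  ∀ (e e' c₁ c₂ : KAT.Carrier 𝔸) (Q R : KAT.Carrier (BiKAT.Ä D)) →
    KAT.𝔹 𝔸 e → KAT.𝔹 𝔸 e' → KAT.𝔹 (BiKAT.Ä D) Q → KAT.𝔹 (BiKAT.Ä D) R →
    StarIdentity D e e' c₁ c₂ Q R

{-# OPTIONS --safe #-}
-- (a) With a = ⟨e;c], b = [e';c'⟩, f = ⟨¬e], f' = [¬e'⟩ and X the loop body on the right of (∗):
-- a and b commute, as do a and f', f and b, so every summand of X maps a*;f;b*;f' into itself
-- and star induction gives X*;f;f' ≤ a*;f;b*;f'.  Conversely, by *-continuity it suffices to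
-- bound each aⁿ;bᵐ;f;f', which goes by induction on (n, m): splitting on the bitests Q and R
-- selects the summand of X that consumes one a, one b, or one of each.
-- (b) The premises say exactly that every summand of X preserves P (the last one excludes the
-- states in which only one loop is still running while Q resp. R does not hold), so X* preserves
-- P, and by (∗) the program is X*;⟨¬e∣¬e'⟩, after which P;⟨¬e∣¬e'⟩ holds.
module Submission where

open import Defs
open import Level using (Level)
open import Data.Nat using (ℕ; zero; suc)
open import Data.Product using (_,_; _×_; proj₁; proj₂)
open import Relation.Binary.PropositionalEquality
open import Algebra.Bundles using (Monoid)
open import Relation.Binary.Bundles using (Poset)
import Relation.Binary.Reasoning.PartialOrder as PosetReasoning
open import Tactic.MonoidSolver using (solve)

module KATProperties {c} (K : KAT c) where
  open KAT K

  ·-monoid : Monoid c c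
  ·-monoid = record
    { Carrier  = Carrier
    ; _≈_      = _≡_
    ; _∙_      = _·_
    ; ε        = 1#
    ; isMonoid = record
      { isSemigroup = record
        { isMagma = record { isEquivalence = isEquivalence ; ∙-cong = cong₂ _·_ }
        ; assoc   = ·-assoc }
      ; identity = ·-identityˡ , ·-identityʳ } }

  +-identityʳ : ∀ x → x + 0# ≡ x
  +-identityʳ x = trans (+-comm x 0#) (+-identityˡ x)

  ≤-refl : ∀ {x} → x ≤ x
  ≤-refl {x} = +-idem x

  ≤-reflexive : ∀ {x y} → x ≡ y → x ≤ y
  ≤-reflexive refl = ≤-refl

  ≤-trans : ∀ {x y z} → x ≤ y → y ≤ z → x ≤ z
  ≤-trans {x} {y} {z} x≤y y≤z = begin
    x + z       ≡⟨ cong (x +_) (sym y≤z) ⟩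
    x + (y + z) ≡⟨ sym (+-assoc x y z) ⟩
    x + y + z   ≡⟨ cong (_+ z) x≤y ⟩
    y + z       ≡⟨ y≤z ⟩
    z           ∎
    where open ≡-Reasoning

  ≤-antisym : ∀ {x y} → x ≤ y → y ≤ x → x ≡ y
  ≤-antisym {x} {y} x≤y y≤x = trans (sym y≤x) (trans (+-comm y x) x≤y)

  ≤-poset : Poset c c c
  ≤-poset = record
    { _≈_ = _≡_
    ; _≤_ = _≤_
    ; isPartialOrder = record
      { isPreorder = record { isEquivalence = isEquivalence ; reflexive = ≤-reflexive ; trans = ≤-trans }
      ; antisym = ≤-antisym } }

  module ≤-Reasoning = PosetReasoning ≤-poset

  x≤x+y : ∀ x y → x ≤ x + y
  x≤x+y x y = trans (sym (+-assoc x x y)) (cong (_+ y) (+-idem x))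

  y≤x+y : ∀ x y → y ≤ x + y
  y≤x+y x y = subst (y ≤_) (+-comm y x) (x≤x+y y x)

  +-lub : ∀ {x y z} → x ≤ z → y ≤ z → x + y ≤ z
  +-lub {x} {y} {z} x≤z y≤z = trans (+-assoc x y z) (trans (cong (x +_) y≤z) x≤z)

  x≤0⇒x≡0 : ∀ {x} → x ≤ 0# → x ≡ 0#
  x≤0⇒x≡0 {x} x≤0 = trans (sym (+-identityʳ x)) x≤0

  ·-monoˡ-≤ : ∀ {x y} z → x ≤ y → x · z ≤ y · z
  ·-monoˡ-≤ {x} {y} z x≤y = trans (sym (distribʳ z x y)) (cong (_· z) x≤y)

  ·-monoʳ-≤ : ∀ {x y} z → x ≤ y → z · x ≤ z · y
  ·-monoʳ-≤ {x} {y} z x≤y = trans (sym (distribˡ z x y)) (cong (z ·_) x≤y)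

  ·-mono-≤ : ∀ {x x' y y'} → x ≤ x' → y ≤ y' → x · y ≤ x' · y'
  ·-mono-≤ {y = y} {x'} x≤x' y≤y' = ≤-trans (·-monoˡ-≤ y x≤x') (·-monoʳ-≤ _ y≤y')

  t≤1 : ∀ {t} → 𝔹 t → t ≤ 1#
  t≤1 {t} 𝔹t = begin
    t + 1#         ≡⟨ cong (t +_) (sym (𝔹-compl₁ 𝔹t)) ⟩
    t + (t + ¬ t)  ≡⟨ x≤x+y t (¬ t) ⟩
    t + ¬ t        ≡⟨ 𝔹-compl₁ 𝔹t ⟩
    1#             ∎
    where open ≡-Reasoning

  t·x≤x : ∀ {t} x → 𝔹 t → t · x ≤ x
  t·x≤x x 𝔹t = ≤-trans (·-monoˡ-≤ x (t≤1 𝔹t)) (≤-reflexive (·-identityˡ x))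

  x·t≤x : ∀ {t} x → 𝔹 t → x · t ≤ x
  x·t≤x x 𝔹t = ≤-trans (·-monoʳ-≤ x (t≤1 𝔹t)) (≤-reflexive (·-identityʳ x))

  𝔹-absorbʳ : ∀ {s t} → 𝔹 s → 𝔹 t → s ≤ t → s · t ≡ s
  𝔹-absorbʳ {s} 𝔹s 𝔹t s≤t = trans (cong (s ·_) (sym s≤t)) (𝔹-absorb₂ 𝔹s 𝔹t)

  𝔹-idem : ∀ {t} → 𝔹 t → t · t ≡ t
  𝔹-idem 𝔹t = 𝔹-absorbʳ 𝔹t 𝔹t ≤-refl

  𝔹-compl₂ʳ : ∀ {t} → 𝔹 t → ¬ t · t ≡ 0#
  𝔹-compl₂ʳ 𝔹t = trans (𝔹-·-comm (𝔹-¬ 𝔹t) 𝔹t) (𝔹-compl₂ 𝔹t)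

  𝔹-disjoint-mono : ∀ {s t g h} → 𝔹 s → 𝔹 t → 𝔹 g → 𝔹 h →
                    s ≤ g → t ≤ h → g · h ≡ 0# → s · t ≡ 0#
  𝔹-disjoint-mono {s} {t} {g} {h} 𝔹s 𝔹t 𝔹g 𝔹h s≤g t≤h gh≡0 = begin
    s · t              ≡⟨ cong₂ _·_ (sym (𝔹-absorbʳ 𝔹s 𝔹g s≤g))
                                    (sym (trans (𝔹-·-comm 𝔹h 𝔹t) (𝔹-absorbʳ 𝔹t 𝔹h t≤h))) ⟩
    (s · g) · (h · t)  ≡⟨ solve ·-monoid ⟩
    s · ((g · h) · t)  ≡⟨ cong (λ u → s · (u · t)) gh≡0 ⟩
    s · (0# · t)       ≡⟨ trans (cong (s ·_) (zeroˡ t)) (zeroʳ s) ⟩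
    0#                 ∎
    where open ≡-Reasoning

  𝔹-≤-annihilate : ∀ {p s u} → 𝔹 p → 𝔹 s → p ≤ s → s · u ≡ 0# → p · u ≡ 0#
  𝔹-≤-annihilate {p} {s} {u} 𝔹p 𝔹s p≤s su≡0 = begin
    p · u        ≡⟨ cong (_· u) (sym (𝔹-absorbʳ 𝔹p 𝔹s p≤s)) ⟩
    p · s · u    ≡⟨ ·-assoc p s u ⟩
    p · (s · u)  ≡⟨ trans (cong (p ·_) su≡0) (zeroʳ p) ⟩
    0#           ∎
    where open ≡-Reasoning

  𝔹-cases : ∀ {q x w} → 𝔹 q → q · x ≤ w → ¬ q · x ≤ w → x ≤ w
  𝔹-cases {q} {x} {w} 𝔹q qx≤w ¬qx≤w = subst (_≤ w) split (+-lub qx≤w ¬qx≤w)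
    where
      split : q · x + ¬ q · x ≡ x
      split = trans (sym (distribʳ x q (¬ q))) (trans (cong (_· x) (𝔹-compl₁ 𝔹q)) (·-identityˡ x))

  +-·-zero : ∀ {s t u} → s · u ≡ 0# → t · u ≡ 0# → (s + t) · u ≡ 0#
  +-·-zero {s} {t} {u} su≡0 tu≡0 =
    trans (distribʳ u s t) (trans (cong₂ _+_ su≡0 tu≡0) (+-idem 0#))

  ·-zero-prefix : ∀ {p u} x y → p · u ≡ 0# → p · (u · x) · y ≡ 0#
  ·-zero-prefix {p} {u} x y pu≡0 = begin
    p · (u · x) · y   ≡⟨ solve ·-monoid ⟩
    p · u · (x · y)   ≡⟨ cong (_· (x · y)) pu≡0 ⟩
    0# · (x · y)      ≡⟨ zeroˡ (x · y) ⟩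
    0#                ∎
    where open ≡-Reasoning

  1≤x* : ∀ x → 1# ≤ x *
  1≤x* x = ≤-trans (x≤x+y 1# (x · x *)) (*-unfoldˡ x)

  x·x*≤x* : ∀ x → x · x * ≤ x *
  x·x*≤x* x = ≤-trans (y≤x+y 1# (x · x *)) (*-unfoldˡ x)

  x*·x≤x* : ∀ x → x * · x ≤ x *
  x*·x≤x* x = ≤-trans (y≤x+y 1# (x * · x)) (*-unfoldʳ x)

  ^-comm : ∀ {x y} → x · y ≡ y · x → ∀ n → x ^ n · y ≡ y · x ^ n
  ^-comm {x} {y} xy≡yx zero = trans (·-identityˡ y) (sym (·-identityʳ y))
  ^-comm {x} {y} xy≡yx (suc n) = begin
    x · x ^ n · y     ≡⟨ ·-assoc x (x ^ n) y ⟩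
    x · (x ^ n · y)   ≡⟨ cong (x ·_) (^-comm xy≡yx n) ⟩
    x · (y · x ^ n)   ≡⟨ sym (·-assoc x y (x ^ n)) ⟩
    x · y · x ^ n     ≡⟨ cong (_· x ^ n) xy≡yx ⟩
    y · x · x ^ n     ≡⟨ ·-assoc y x (x ^ n) ⟩
    y · (x · x ^ n)   ∎
    where open ≡-Reasoning

  *-simulationʳ : ∀ {p x} → p · x ≤ x · p → p · x * ≤ x * · p
  *-simulationʳ {p} {x} px≤xp = *-indʳ x (x * · p) p (+-lub base step)
    where
      base : p ≤ x * · p
      base = ≤-trans (≤-reflexive (sym (·-identityˡ p))) (·-monoˡ-≤ p (1≤x* x))
      step : x * · p · x ≤ x * · p
      step = begin
        x * · p · x     ≡⟨ ·-assoc (x *) p x ⟩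
        x * · (p · x)   ≤⟨ ·-monoʳ-≤ (x *) px≤xp ⟩
        x * · (x · p)   ≡⟨ sym (·-assoc (x *) x p) ⟩
        x * · x · p     ≤⟨ ·-monoˡ-≤ p (x*·x≤x* x) ⟩
        x * · p         ∎
        where open ≤-Reasoning

  *-simulationˡ : ∀ {p x} → x · p ≤ p · x → x * · p ≤ p · x *
  *-simulationˡ {p} {x} xp≤px = *-indˡ x (p · x *) p (+-lub base step)
    where
      base : p ≤ p · x *
      base = ≤-trans (≤-reflexive (sym (·-identityʳ p))) (·-monoʳ-≤ p (1≤x* x))
      step : x · (p · x *) ≤ p · x *
      step = begin
        x · (p · x *)   ≡⟨ sym (·-assoc x p (x *)) ⟩
        x · p · x *     ≤⟨ ·-monoˡ-≤ (x *) xp≤px ⟩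
        p · x · x *     ≡⟨ ·-assoc p x (x *) ⟩
        p · (x · x *)   ≤⟨ ·-monoʳ-≤ p (x·x*≤x* x) ⟩
        p · x *         ∎
        where open ≤-Reasoning

  *-comm : ∀ {x y} → x · y ≡ y · x → x * · y ≡ y · x *
  *-comm xy≡yx = ≤-antisym (*-simulationˡ (≤-reflexive xy≡yx))
                           (*-simulationʳ (≤-reflexive (sym xy≡yx)))

  *-continuity-lub : StarContinuous K → ∀ {x y z w} →
                     (∀ n → x · y ^ n · z ≤ w) → x · y * · z ≤ w
  *-continuity-lub continuous {x} {y} {z} {w} = proj₂ (continuous x y z) w

  Invariant : Carrier → Carrier → Set c
  Invariant p x = p · x · ¬ p ≡ 0#

  invariant⇒·p : ∀ {p x} → 𝔹 p → Invariant p x → p · x · p ≡ p · x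
  invariant⇒·p {p} {x} 𝔹p inv = begin
    p · x · p                  ≡⟨ sym (+-identityʳ (p · x · p)) ⟩
    p · x · p + 0#             ≡⟨ cong (p · x · p +_) (sym inv) ⟩
    p · x · p + p · x · ¬ p    ≡⟨ sym (distribˡ (p · x) p (¬ p)) ⟩
    p · x · (p + ¬ p)          ≡⟨ cong (p · x ·_) (𝔹-compl₁ 𝔹p) ⟩
    p · x · 1#                 ≡⟨ ·-identityʳ (p · x) ⟩
    p · x                      ∎
    where open ≡-Reasoning

  invariant⇒≤ : ∀ {p x} → 𝔹 p → Invariant p x → p · x ≤ x · p
  invariant⇒≤ {p} {x} 𝔹p inv = begin
    p · x          ≡⟨ sym (invariant⇒·p 𝔹p inv) ⟩
    p · x · p      ≡⟨ ·-assoc p x p ⟩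
    p · (x · p)    ≤⟨ t·x≤x (x · p) 𝔹p ⟩
    x · p          ∎
    where open ≤-Reasoning

  invariant-+ : ∀ {p x y} → Invariant p x → Invariant p y → Invariant p (x + y)
  invariant-+ {p} {x} {y} inv-x inv-y = begin
    p · (x + y) · ¬ p               ≡⟨ cong (_· ¬ p) (distribˡ p x y) ⟩
    (p · x + p · y) · ¬ p           ≡⟨ distribʳ (¬ p) (p · x) (p · y) ⟩
    p · x · ¬ p + p · y · ¬ p       ≡⟨ cong₂ _+_ inv-x inv-y ⟩
    0# + 0#                         ≡⟨ +-idem 0# ⟩
    0#                              ∎
    where open ≡-Reasoning

  invariant-* : ∀ {p x} → 𝔹 p → Invariant p x → Invariant p (x *)
  invariant-* {p} {x} 𝔹p inv = x≤0⇒x≡0 (begin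
    p · x * · ¬ p      ≤⟨ ·-monoˡ-≤ (¬ p) (*-simulationʳ (invariant⇒≤ 𝔹p inv)) ⟩
    x * · p · ¬ p      ≡⟨ ·-assoc (x *) p (¬ p) ⟩
    x * · (p · ¬ p)    ≡⟨ cong (x * ·_) (𝔹-compl₂ 𝔹p) ⟩
    x * · 0#           ≡⟨ zeroʳ (x *) ⟩
    0#                 ∎)
    where open ≤-Reasoning

  invariant-guard : ∀ {p f x} → 𝔹 p → 𝔹 f → Invariant p x → p · (x · f) · ¬ (p · f) ≡ 0#
  invariant-guard {p} {f} {x} 𝔹p 𝔹f inv = begin
    p · (x · f) · ¬ (p · f)      ≡⟨ solve ·-monoid ⟩
    p · x · f · ¬ (p · f)        ≡⟨ cong (λ u → u · f · ¬ (p · f)) (sym (invariant⇒·p 𝔹p inv)) ⟩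
    p · x · p · f · ¬ (p · f)    ≡⟨ solve ·-monoid ⟩
    p · x · (p · f · ¬ (p · f))  ≡⟨ cong (p · x ·_) (𝔹-compl₂ (𝔹-· 𝔹p 𝔹f)) ⟩
    p · x · 0#                   ≡⟨ zeroʳ (p · x) ⟩
    0#                           ∎
    where open ≡-Reasoning

module Interleaving {c} (K : KAT c) where
  open KAT K
  open KATProperties K

  module _ {a b f f' q r : Carrier} (𝔹f : 𝔹 f) (𝔹f' : 𝔹 f') (𝔹q : 𝔹 q) (𝔹r : 𝔹 r)
           (ab≡ba : a · b ≡ b · a) (af'≡f'a : a · f' ≡ f' · a) (fb≡bf : f · b ≡ b · f) where

    step : Carrier
    step = q · a + r · b + ¬ q · ¬ r · (a · b) + ¬ q · (a · f') + ¬ r · (f · b)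

    sequential : Carrier
    sequential = a * · f · b * · f'

    merged : Carrier
    merged = step * · (f · f')

    AbsorbedBySequential : Carrier → Set c
    AbsorbedBySequential s = s · sequential ≤ sequential

    absorbed-test : ∀ {t} → 𝔹 t → AbsorbedBySequential t
    absorbed-test 𝔹t = t·x≤x sequential 𝔹t

    absorbed-· : ∀ {s t} → AbsorbedBySequential s → AbsorbedBySequential t →
                 AbsorbedBySequential (s · t)
    absorbed-· {s} {t} s-abs t-abs =
      ≤-trans (≤-reflexive (·-assoc s t sequential)) (≤-trans (·-monoʳ-≤ s t-abs) s-abs)

    absorbed-+ : ∀ {s t} → AbsorbedBySequential s → AbsorbedBySequential t →
                 AbsorbedBySequential (s + t)
    absorbed-+ {s} {t} s-abs t-abs =
      subst (_≤ sequential) (sym (distribʳ sequential s t)) (+-lub s-abs t-abs)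

    absorbed-a : AbsorbedBySequential a
    absorbed-a = begin
      a · (a * · f · b * · f')   ≡⟨ solve ·-monoid ⟩
      a · a * · f · b * · f'     ≤⟨ ·-monoˡ-≤ f' (·-monoˡ-≤ (b *) (·-monoˡ-≤ f (x·x*≤x* a))) ⟩
      a * · f · b * · f'         ∎
      where open ≤-Reasoning

    absorbed-b : AbsorbedBySequential b
    absorbed-b = begin
      b · (a * · f · b * · f')   ≡⟨ solve ·-monoid ⟩
      b · a * · f · b * · f'     ≡⟨ cong (λ u → u · f · b * · f') (sym (*-comm ab≡ba)) ⟩
      a * · b · f · b * · f'     ≡⟨ solve ·-monoid ⟩
      a * · (b · f) · b * · f'   ≡⟨ cong (λ u → a * · u · b * · f') (sym fb≡bf) ⟩
      a * · (f · b) · b * · f'   ≡⟨ solve ·-monoid ⟩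
      a * · f · (b · b *) · f'   ≤⟨ ·-monoˡ-≤ f' (·-monoʳ-≤ (a * · f) (x·x*≤x* b)) ⟩
      a * · f · b * · f'         ∎
      where open ≤-Reasoning

    absorbed-step : AbsorbedBySequential step
    absorbed-step =
      absorbed-+ (absorbed-+ (absorbed-+ (absorbed-+
        (absorbed-· (absorbed-test 𝔹q) absorbed-a)
        (absorbed-· (absorbed-test 𝔹r) absorbed-b))
        (absorbed-· (absorbed-test (𝔹-· (𝔹-¬ 𝔹q) (𝔹-¬ 𝔹r))) (absorbed-· absorbed-a absorbed-b)))
        (absorbed-· (absorbed-test (𝔹-¬ 𝔹q)) (absorbed-· absorbed-a (absorbed-test 𝔹f'))))
        (absorbed-· (absorbed-test (𝔹-¬ 𝔹r)) (absorbed-· (absorbed-test 𝔹f) absorbed-b))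

    ff'≤sequential : f · f' ≤ sequential
    ff'≤sequential = begin
      f · f'                ≡⟨ solve ·-monoid ⟩
      1# · f · 1# · f'      ≤⟨ ·-monoˡ-≤ f' (·-mono-≤ (·-monoˡ-≤ f (1≤x* a)) (1≤x* b)) ⟩
      a * · f · b * · f'    ∎
      where open ≤-Reasoning

    merged≤sequential : merged ≤ sequential
    merged≤sequential = *-indˡ step sequential (f · f') (+-lub ff'≤sequential absorbed-step)

    q·a≤step : q · a ≤ step
    q·a≤step = ≤-trans (x≤x+y _ _) (≤-trans (x≤x+y _ _) (≤-trans (x≤x+y _ _) (x≤x+y _ _)))

    r·b≤step : r · b ≤ step
    r·b≤step = ≤-trans (y≤x+y _ _) (≤-trans (x≤x+y _ _) (≤-trans (x≤x+y _ _) (x≤x+y _ _)))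

    ¬q·¬r·ab≤step : ¬ q · ¬ r · (a · b) ≤ step
    ¬q·¬r·ab≤step = ≤-trans (y≤x+y _ _) (≤-trans (x≤x+y _ _) (x≤x+y _ _))

    ¬q·af'≤step : ¬ q · (a · f') ≤ step
    ¬q·af'≤step = ≤-trans (y≤x+y _ _) (x≤x+y _ _)

    ¬r·fb≤step : ¬ r · (f · b) ≤ step
    ¬r·fb≤step = y≤x+y _ _

    merged-unfold : ∀ {t y} → t ≤ step → y ≤ merged → t · y ≤ merged
    merged-unfold {t} {y} t≤step y≤merged = begin
      t · y                       ≤⟨ ·-mono-≤ t≤step y≤merged ⟩
      step · (step * · (f · f'))  ≡⟨ sym (·-assoc step (step *) (f · f')) ⟩
      step · step * · (f · f')    ≤⟨ ·-monoˡ-≤ (f · f') (x·x*≤x* step) ⟩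
      merged                      ∎
      where open ≤-Reasoning

    run : ℕ → ℕ → Carrier
    run n m = a ^ n · b ^ m · (f · f')

    run-sucˡ : ∀ n m → run (suc n) m ≡ a · run n m
    run-sucˡ n m = solve ·-monoid

    run-sucʳ : ∀ n m → run n (suc m) ≡ b · run n m
    run-sucʳ n m = begin
      a ^ n · (b · b ^ m) · (f · f')   ≡⟨ solve ·-monoid ⟩
      a ^ n · b · b ^ m · (f · f')     ≡⟨ cong (λ u → u · b ^ m · (f · f')) (^-comm ab≡ba n) ⟩
      b · a ^ n · b ^ m · (f · f')     ≡⟨ solve ·-monoid ⟩
      b · run n m                      ∎
      where open ≡-Reasoning

    f'·run≡run : ∀ n → f' · run n 0 ≡ run n 0
    f'·run≡run n = begin
      f' · (a ^ n · 1# · (f · f'))   ≡⟨ solve ·-monoid ⟩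
      f' · a ^ n · (f · f')          ≡⟨ cong (_· (f · f')) (sym (^-comm af'≡f'a n)) ⟩
      a ^ n · f' · (f · f')          ≡⟨ solve ·-monoid ⟩
      a ^ n · (f' · f · f')          ≡⟨ cong (λ u → a ^ n · (u · f')) (𝔹-·-comm 𝔹f' 𝔹f) ⟩
      a ^ n · (f · f' · f')          ≡⟨ cong (a ^ n ·_) (·-assoc f f' f') ⟩
      a ^ n · (f · (f' · f'))        ≡⟨ cong (λ u → a ^ n · (f · u)) (𝔹-idem 𝔹f') ⟩
      a ^ n · (f · f')               ≡⟨ solve ·-monoid ⟩
      a ^ n · 1# · (f · f')          ∎
      where open ≡-Reasoning

    f·run≡run : ∀ m → f · run 0 m ≡ run 0 m
    f·run≡run m = begin
      f · (1# · b ^ m · (f · f'))   ≡⟨ solve ·-monoid ⟩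
      f · b ^ m · (f · f')          ≡⟨ cong (_· (f · f')) (sym (^-comm (sym fb≡bf) m)) ⟩
      b ^ m · f · (f · f')          ≡⟨ solve ·-monoid ⟩
      b ^ m · (f · f · f')          ≡⟨ cong (λ u → b ^ m · (u · f')) (𝔹-idem 𝔹f) ⟩
      b ^ m · (f · f')              ≡⟨ solve ·-monoid ⟩
      1# · b ^ m · (f · f')         ∎
      where open ≡-Reasoning

    run≤merged : ∀ n m → run n m ≤ merged
    run≤merged zero zero = begin
      1# · 1# · (f · f')         ≡⟨ solve ·-monoid ⟩
      1# · (f · f')              ≤⟨ ·-monoˡ-≤ (f · f') (1≤x* step) ⟩
      merged                     ∎
      where open ≤-Reasoning
    run≤merged (suc n) zero = 𝔹-cases 𝔹q
      (begin
        q · run (suc n) 0                 ≡⟨ cong (q ·_) (run-sucˡ n 0) ⟩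
        q · (a · run n 0)                 ≡⟨ sym (·-assoc q a (run n 0)) ⟩
        q · a · run n 0                   ≤⟨ merged-unfold q·a≤step (run≤merged n 0) ⟩
        merged                            ∎)
      (begin
        ¬ q · run (suc n) 0               ≡⟨ cong (¬ q ·_) (trans (run-sucˡ n 0) (cong (a ·_) (sym (f'·run≡run n)))) ⟩
        ¬ q · (a · (f' · run n 0))        ≡⟨ solve ·-monoid ⟩
        ¬ q · (a · f') · run n 0          ≤⟨ merged-unfold ¬q·af'≤step (run≤merged n 0) ⟩
        merged                            ∎)
      where open ≤-Reasoning
    run≤merged zero (suc m) = 𝔹-cases 𝔹r
      (begin
        r · run 0 (suc m)                 ≡⟨ cong (r ·_) (run-sucʳ 0 m) ⟩
        r · (b · run 0 m)                 ≡⟨ sym (·-assoc r b (run 0 m)) ⟩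
        r · b · run 0 m                   ≤⟨ merged-unfold r·b≤step (run≤merged 0 m) ⟩
        merged                            ∎)
      (begin
        ¬ r · run 0 (suc m)               ≡⟨ cong (¬ r ·_) (trans (run-sucʳ 0 m) (cong (b ·_) (sym (f·run≡run m)))) ⟩
        ¬ r · (b · (f · run 0 m))         ≡⟨ solve ·-monoid ⟩
        ¬ r · (b · f) · run 0 m           ≡⟨ cong (λ u → ¬ r · u · run 0 m) (sym fb≡bf) ⟩
        ¬ r · (f · b) · run 0 m           ≤⟨ merged-unfold ¬r·fb≤step (run≤merged 0 m) ⟩
        merged                            ∎)
      where open ≤-Reasoning
    run≤merged (suc n) (suc m) = 𝔹-cases 𝔹q
      (begin
        q · run (suc n) (suc m)           ≡⟨ cong (q ·_) (run-sucˡ n (suc m)) ⟩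
        q · (a · run n (suc m))           ≡⟨ sym (·-assoc q a (run n (suc m))) ⟩
        q · a · run n (suc m)             ≤⟨ merged-unfold q·a≤step (run≤merged n (suc m)) ⟩
        merged                            ∎)
      (𝔹-cases 𝔹r
        (begin
          r · (¬ q · run (suc n) (suc m)) ≤⟨ ·-monoʳ-≤ r (t·x≤x _ (𝔹-¬ 𝔹q)) ⟩
          r · run (suc n) (suc m)         ≡⟨ cong (r ·_) (run-sucʳ (suc n) m) ⟩
          r · (b · run (suc n) m)         ≡⟨ sym (·-assoc r b (run (suc n) m)) ⟩
          r · b · run (suc n) m           ≤⟨ merged-unfold r·b≤step (run≤merged (suc n) m) ⟩
          merged                          ∎)
        (begin
          ¬ r · (¬ q · run (suc n) (suc m)) ≡⟨ sym (·-assoc (¬ r) (¬ q) _) ⟩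
          ¬ r · ¬ q · run (suc n) (suc m)   ≡⟨ cong₂ _·_ (𝔹-·-comm (𝔹-¬ 𝔹r) (𝔹-¬ 𝔹q))
                                                 (trans (run-sucˡ n (suc m)) (cong (a ·_) (run-sucʳ n m))) ⟩
          ¬ q · ¬ r · (a · (b · run n m))   ≡⟨ solve ·-monoid ⟩
          ¬ q · ¬ r · (a · b) · run n m     ≤⟨ merged-unfold ¬q·¬r·ab≤step (run≤merged n m) ⟩
          merged                            ∎))
      where open ≤-Reasoning

    sequential≤merged : StarContinuous K → sequential ≤ merged
    sequential≤merged continuous = begin
      a * · f · b * · f'          ≡⟨ solve ·-monoid ⟩
      1# · a * · (f · b * · f')   ≤⟨ *-continuity-lub continuous outer ⟩
      merged                      ∎
      where
        open ≤-Reasoning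
        inner : ∀ n m → a ^ n · f · b ^ m · f' ≤ merged
        inner n m = begin
          a ^ n · f · b ^ m · f'      ≡⟨ solve ·-monoid ⟩
          a ^ n · (f · b ^ m) · f'    ≡⟨ cong (λ u → a ^ n · u · f') (sym (^-comm (sym fb≡bf) m)) ⟩
          a ^ n · (b ^ m · f) · f'    ≡⟨ solve ·-monoid ⟩
          run n m                     ≤⟨ run≤merged n m ⟩
          merged                      ∎
        outer : ∀ n → 1# · a ^ n · (f · b * · f') ≤ merged
        outer n = begin
          1# · a ^ n · (f · b * · f')  ≡⟨ solve ·-monoid ⟩
          a ^ n · f · b * · f'         ≤⟨ *-continuity-lub continuous (inner n) ⟩
          merged                       ∎

    sequential≡merged : StarContinuous K → sequential ≡ merged
    sequential≡merged continuous = ≤-antisym (sequential≤merged continuous) merged≤sequential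

module BiKATProperties {c} {𝔸 : KAT c} (D : BiKAT 𝔸) where
  open KAT 𝔸 using (Carrier; _·_; _*; 1#; ¬_; 𝔹; 𝔹-¬)
  open BiKAT D
  module Ä = KAT Ä
  module ⟨]-hom = IsKATHom ⟨]-hom
  module [⟩-hom = IsKATHom [⟩-hom
  open KATProperties Ä

  ⟨∣⟩-· : ∀ x y x' y' → ⟨ x · y ∣ x' · y' ⟩ ≡ ⟨ x ∣ x' ⟩ ⨾ ⟨ y ∣ y' ⟩
  ⟨∣⟩-· x y x' y' = begin
    ⟨ x · y ] ⨾ [ x' · y' ⟩                ≡⟨ cong₂ _⨾_ (⟨]-hom.hom-· x y) ([⟩-hom.hom-· x' y') ⟩
    ⟨ x ] ⨾ ⟨ y ] ⨾ ([ x' ⟩ ⨾ [ y' ⟩)      ≡⟨ solve ·-monoid ⟩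
    ⟨ x ] ⨾ (⟨ y ] ⨾ [ x' ⟩) ⨾ [ y' ⟩      ≡⟨ cong (λ u → ⟨ x ] ⨾ u ⨾ [ y' ⟩) (⟨]-[⟩-comm y x') ⟩
    ⟨ x ] ⨾ ([ x' ⟩ ⨾ ⟨ y ]) ⨾ [ y' ⟩      ≡⟨ solve ·-monoid ⟩
    ⟨ x ] ⨾ [ x' ⟩ ⨾ (⟨ y ] ⨾ [ y' ⟩)      ∎
    where open ≡-Reasoning

  ⟨∣⟩-·ˡ : ∀ x y z → ⟨ x · y ∣ z ⟩ ≡ ⟨ x ∣ z ⟩ ⨾ ⟨ y ∣ 1# ⟩
  ⟨∣⟩-·ˡ x y z = trans (cong (λ u → ⟨ x · y ∣ u ⟩) (sym (KAT.·-identityʳ 𝔸 z))) (⟨∣⟩-· x y z 1#)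

  ⟨∣⟩-·ʳ : ∀ x y z → ⟨ x ∣ y · z ⟩ ≡ ⟨ x ∣ y ⟩ ⨾ ⟨ 1# ∣ z ⟩
  ⟨∣⟩-·ʳ x y z = trans (cong (λ u → ⟨ u ∣ y · z ⟩) (sym (KAT.·-identityʳ 𝔸 x))) (⟨∣⟩-· x 1# y z)

  ⟨]-· : ∀ x y → ⟨ x · y ] ≡ ⟨ x ] ⨾ ⟨ y ∣ 1# ⟩
  ⟨]-· x y = begin
    ⟨ x · y ]               ≡⟨ ⟨]-hom.hom-· x y ⟩
    ⟨ x ] ⨾ ⟨ y ]           ≡⟨ cong (⟨ x ] ⨾_) (sym (Ä.·-identityʳ ⟨ y ])) ⟩
    ⟨ x ] ⨾ (⟨ y ] ⨾ Ä.1#)  ≡⟨ cong (λ u → ⟨ x ] ⨾ (⟨ y ] ⨾ u)) (sym [⟩-hom.hom-1) ⟩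
    ⟨ x ] ⨾ ⟨ y ∣ 1# ⟩      ∎
    where open ≡-Reasoning

  [⟩-· : ∀ x y → [ x · y ⟩ ≡ [ x ⟩ ⨾ ⟨ 1# ∣ y ⟩
  [⟩-· x y = begin
    [ x · y ⟩               ≡⟨ [⟩-hom.hom-· x y ⟩
    [ x ⟩ ⨾ [ y ⟩           ≡⟨ cong ([ x ⟩ ⨾_) (sym (Ä.·-identityˡ [ y ⟩)) ⟩
    [ x ⟩ ⨾ (Ä.1# ⨾ [ y ⟩)  ≡⟨ cong (λ u → [ x ⟩ ⨾ (u ⨾ [ y ⟩)) (sym ⟨]-hom.hom-1) ⟩
    [ x ⟩ ⨾ ⟨ 1# ∣ y ⟩      ∎
    where open ≡-Reasoning

  ⟨∣⟩-*· : ∀ x s y t → ⟨ x * · s ∣ y * · t ⟩ ≡ ⟨ x ] ⊛ ⨾ ⟨ s ] ⨾ [ y ⟩ ⊛ ⨾ [ t ⟩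
  ⟨∣⟩-*· x s y t = begin
    ⟨ x * · s ] ⨾ [ y * · t ⟩                 ≡⟨ cong₂ _⨾_ (⟨]-hom.hom-· (x *) s) ([⟩-hom.hom-· (y *) t) ⟩
    ⟨ x * ] ⨾ ⟨ s ] ⨾ ([ y * ⟩ ⨾ [ t ⟩)       ≡⟨ cong₂ (λ u v → u ⨾ ⟨ s ] ⨾ (v ⨾ [ t ⟩)) (⟨]-hom.hom-* x) ([⟩-hom.hom-* y) ⟩
    ⟨ x ] ⊛ ⨾ ⟨ s ] ⨾ ([ y ⟩ ⊛ ⨾ [ t ⟩)       ≡⟨ solve ·-monoid ⟩
    ⟨ x ] ⊛ ⨾ ⟨ s ] ⨾ [ y ⟩ ⊛ ⨾ [ t ⟩         ∎
    where open ≡-Reasoning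

  ⟨]-compl₂ : ∀ {t} → 𝔹 t → ⟨ t ] ⨾ ⟨ ¬ t ] ≡ 𝟘
  ⟨]-compl₂ 𝔹t = trans (cong (⟨ _ ] ⨾_) (⟨]-hom.hom-¬ 𝔹t)) (Ä.𝔹-compl₂ (⟨]-hom.hom-𝔹 𝔹t))

  ⟨]-compl₂ʳ : ∀ {t} → 𝔹 t → ⟨ ¬ t ] ⨾ ⟨ t ] ≡ 𝟘
  ⟨]-compl₂ʳ 𝔹t = trans (cong (_⨾ ⟨ _ ]) (⟨]-hom.hom-¬ 𝔹t)) (𝔹-compl₂ʳ (⟨]-hom.hom-𝔹 𝔹t))

  [⟩-compl₂ : ∀ {t} → 𝔹 t → [ t ⟩ ⨾ [ ¬ t ⟩ ≡ 𝟘
  [⟩-compl₂ 𝔹t = trans (cong ([ _ ⟩ ⨾_) ([⟩-hom.hom-¬ 𝔹t)) (Ä.𝔹-compl₂ ([⟩-hom.hom-𝔹 𝔹t))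

  [⟩-compl₂ʳ : ∀ {t} → 𝔹 t → [ ¬ t ⟩ ⨾ [ t ⟩ ≡ 𝟘
  [⟩-compl₂ʳ 𝔹t = trans (cong (_⨾ [ _ ⟩) ([⟩-hom.hom-¬ 𝔹t)) (𝔹-compl₂ʳ ([⟩-hom.hom-𝔹 𝔹t))

  𝔹̈-⟨∣⟩ : ∀ {t t'} → 𝔹 t → 𝔹 t' → 𝔹̈ ⟨ t ∣ t' ⟩
  𝔹̈-⟨∣⟩ 𝔹t 𝔹t' = Ä.𝔹-· (⟨]-hom.hom-𝔹 𝔹t) ([⟩-hom.hom-𝔹 𝔹t')

  satisfiesStar : StarContinuous Ä → SatisfiesStar D
  satisfiesStar continuous e e' c₁ c₂ Q R 𝔹e 𝔹e' 𝔹Q 𝔹R =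
    Interleaving.sequential≡merged Ä
      (⟨]-hom.hom-𝔹 (𝔹-¬ 𝔹e)) ([⟩-hom.hom-𝔹 (𝔹-¬ 𝔹e')) 𝔹Q 𝔹R
      (⟨]-[⟩-comm (e · c₁) (e' · c₂)) (⟨]-[⟩-comm (e · c₁) (¬ e')) (⟨]-[⟩-comm (¬ e) (e' · c₂))
      continuous

  module _ {e e' c₁ c₂ : Carrier} {P Q R : Ä-Carrier}
           (𝔹e : 𝔹 e) (𝔹e' : 𝔹 e') (𝔹P : 𝔹̈ P) (𝔹Q : 𝔹̈ Q) (𝔹R : 𝔹̈ R)
           (both  : c₁ ∣ c₂ ∶ P ⨾ ⟨ e ∣ e' ⟩ ⨾ ∼ Q ⨾ ∼ R ≈> P)
           (left  : c₁ ∣ 1# ∶ P ⨾ Q ⨾ ⟨ e ] ≈> P)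
           (right : 1# ∣ c₂ ∶ P ⨾ R ⨾ [ e' ⟩ ≈> P)
           (P≤S   : P ≤̈ ⟨ e ∣ e' ⟩ ⊕ ⟨ ¬ e ∣ ¬ e' ⟩ ⊕ Q ⨾ ⟨ e ] ⊕ R ⨾ [ e' ⟩) where

    private
      𝔹E : 𝔹̈ ⟨ e ]
      𝔹E = ⟨]-hom.hom-𝔹 𝔹e
      𝔹N : 𝔹̈ ⟨ ¬ e ]
      𝔹N = ⟨]-hom.hom-𝔹 (𝔹-¬ 𝔹e)
      𝔹E' : 𝔹̈ [ e' ⟩
      𝔹E' = [⟩-hom.hom-𝔹 𝔹e'
      𝔹N' : 𝔹̈ [ ¬ e' ⟩
      𝔹N' = [⟩-hom.hom-𝔹 (𝔹-¬ 𝔹e')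
      𝔹S : 𝔹̈ (⟨ e ∣ e' ⟩ ⊕ ⟨ ¬ e ∣ ¬ e' ⟩ ⊕ Q ⨾ ⟨ e ] ⊕ R ⨾ [ e' ⟩)
      𝔹S = Ä.𝔹-+ (Ä.𝔹-+ (Ä.𝔹-+ (Ä.𝔹-· 𝔹E 𝔹E') (Ä.𝔹-· 𝔹N 𝔹N')) (Ä.𝔹-· 𝔹Q 𝔹E)) (Ä.𝔹-· 𝔹R 𝔹E')

    P·∼Q·⟨e∣¬e'⟩≡0 : P ⨾ (∼ Q ⨾ ⟨ e ∣ ¬ e' ⟩) ≡ 𝟘
    P·∼Q·⟨e∣¬e'⟩≡0 = 𝔹-≤-annihilate 𝔹P 𝔹S P≤S (+-·-zero (+-·-zero (+-·-zero
      (𝔹-disjoint-mono (Ä.𝔹-· 𝔹E 𝔹E') 𝔹U 𝔹E' 𝔹N' (t·x≤x _ 𝔹E) U≤N' ([⟩-compl₂ 𝔹e'))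
      (𝔹-disjoint-mono (Ä.𝔹-· 𝔹N 𝔹N') 𝔹U 𝔹N 𝔹E (x·t≤x _ 𝔹N') U≤E (⟨]-compl₂ʳ 𝔹e)))
      (𝔹-disjoint-mono (Ä.𝔹-· 𝔹Q 𝔹E) 𝔹U 𝔹Q (Ä.𝔹-¬ 𝔹Q) (x·t≤x _ 𝔹E) U≤∼Q (Ä.𝔹-compl₂ 𝔹Q)))
      (𝔹-disjoint-mono (Ä.𝔹-· 𝔹R 𝔹E') 𝔹U 𝔹E' 𝔹N' (t·x≤x _ 𝔹R) U≤N' ([⟩-compl₂ 𝔹e')))
      where
        𝔹U : 𝔹̈ (∼ Q ⨾ ⟨ e ∣ ¬ e' ⟩)
        𝔹U = Ä.𝔹-· (Ä.𝔹-¬ 𝔹Q) (Ä.𝔹-· 𝔹E 𝔹N')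
        U≤∼Q : ∼ Q ⨾ ⟨ e ∣ ¬ e' ⟩ ≤̈ ∼ Q
        U≤∼Q = x·t≤x _ (Ä.𝔹-· 𝔹E 𝔹N')
        U≤E : ∼ Q ⨾ ⟨ e ∣ ¬ e' ⟩ ≤̈ ⟨ e ]
        U≤E = ≤-trans (t·x≤x _ (Ä.𝔹-¬ 𝔹Q)) (x·t≤x _ 𝔹N')
        U≤N' : ∼ Q ⨾ ⟨ e ∣ ¬ e' ⟩ ≤̈ [ ¬ e' ⟩
        U≤N' = ≤-trans (t·x≤x _ (Ä.𝔹-¬ 𝔹Q)) (t·x≤x _ 𝔹E)

    P·∼R·⟨¬e∣e'⟩≡0 : P ⨾ (∼ R ⨾ ⟨ ¬ e ∣ e' ⟩) ≡ 𝟘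
    P·∼R·⟨¬e∣e'⟩≡0 = 𝔹-≤-annihilate 𝔹P 𝔹S P≤S (+-·-zero (+-·-zero (+-·-zero
      (𝔹-disjoint-mono (Ä.𝔹-· 𝔹E 𝔹E') 𝔹U 𝔹E 𝔹N (x·t≤x _ 𝔹E') U≤N (⟨]-compl₂ 𝔹e))
      (𝔹-disjoint-mono (Ä.𝔹-· 𝔹N 𝔹N') 𝔹U 𝔹N' 𝔹E' (t·x≤x _ 𝔹N) U≤E' ([⟩-compl₂ʳ 𝔹e')))
      (𝔹-disjoint-mono (Ä.𝔹-· 𝔹Q 𝔹E) 𝔹U 𝔹E 𝔹N (t·x≤x _ 𝔹Q) U≤N (⟨]-compl₂ 𝔹e)))
      (𝔹-disjoint-mono (Ä.𝔹-· 𝔹R 𝔹E') 𝔹U 𝔹R (Ä.𝔹-¬ 𝔹R) (x·t≤x _ 𝔹E') U≤∼R (Ä.𝔹-compl₂ 𝔹R)))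
      where
        𝔹U : 𝔹̈ (∼ R ⨾ ⟨ ¬ e ∣ e' ⟩)
        𝔹U = Ä.𝔹-· (Ä.𝔹-¬ 𝔹R) (Ä.𝔹-· 𝔹N 𝔹E')
        U≤∼R : ∼ R ⨾ ⟨ ¬ e ∣ e' ⟩ ≤̈ ∼ R
        U≤∼R = x·t≤x _ (Ä.𝔹-· 𝔹N 𝔹E')
        U≤N : ∼ R ⨾ ⟨ ¬ e ∣ e' ⟩ ≤̈ ⟨ ¬ e ]
        U≤N = ≤-trans (t·x≤x _ (Ä.𝔹-¬ 𝔹R)) (x·t≤x _ 𝔹E')
        U≤E' : ∼ R ⨾ ⟨ ¬ e ∣ e' ⟩ ≤̈ [ e' ⟩
        U≤E' = ≤-trans (t·x≤x _ (Ä.𝔹-¬ 𝔹R)) (t·x≤x _ 𝔹N)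

    invariant-body : Invariant P ( Q ⨾ ⟨ e · c₁ ] ⊕ R ⨾ [ e' · c₂ ⟩
                                 ⊕ ∼ Q ⨾ ∼ R ⨾ ⟨ e · c₁ ∣ e' · c₂ ⟩
                                 ⊕ ∼ Q ⨾ ⟨ e · c₁ ∣ ¬ e' ⟩
                                 ⊕ ∼ R ⨾ ⟨ ¬ e ∣ e' · c₂ ⟩ )
    invariant-body = invariant-+ (invariant-+ (invariant-+ (invariant-+ left-step right-step) both-step)
                       left-only-step) right-only-step
      where
        open ≡-Reasoning
        left-step : Invariant P (Q ⨾ ⟨ e · c₁ ])
        left-step = begin
          P ⨾ (Q ⨾ ⟨ e · c₁ ]) ⨾ ∼ P                   ≡⟨ cong (λ u → P ⨾ (Q ⨾ u) ⨾ ∼ P) (⟨]-· e c₁) ⟩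
          P ⨾ (Q ⨾ (⟨ e ] ⨾ ⟨ c₁ ∣ 1# ⟩)) ⨾ ∼ P         ≡⟨ solve ·-monoid ⟩
          P ⨾ Q ⨾ ⟨ e ] ⨾ ⟨ c₁ ∣ 1# ⟩ ⨾ ∼ P             ≡⟨ left ⟩
          𝟘                                            ∎
        right-step : Invariant P (R ⨾ [ e' · c₂ ⟩)
        right-step = begin
          P ⨾ (R ⨾ [ e' · c₂ ⟩) ⨾ ∼ P                  ≡⟨ cong (λ u → P ⨾ (R ⨾ u) ⨾ ∼ P) ([⟩-· e' c₂) ⟩
          P ⨾ (R ⨾ ([ e' ⟩ ⨾ ⟨ 1# ∣ c₂ ⟩)) ⨾ ∼ P        ≡⟨ solve ·-monoid ⟩
          P ⨾ R ⨾ [ e' ⟩ ⨾ ⟨ 1# ∣ c₂ ⟩ ⨾ ∼ P            ≡⟨ right ⟩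
          𝟘                                            ∎
        both-step : Invariant P (∼ Q ⨾ ∼ R ⨾ ⟨ e · c₁ ∣ e' · c₂ ⟩)
        both-step = begin
          P ⨾ (∼ Q ⨾ ∼ R ⨾ ⟨ e · c₁ ∣ e' · c₂ ⟩) ⨾ ∼ P           ≡⟨ cong (λ u → P ⨾ (∼ Q ⨾ ∼ R ⨾ u) ⨾ ∼ P) (⟨∣⟩-· e c₁ e' c₂) ⟩
          P ⨾ (∼ Q ⨾ ∼ R ⨾ (⟨ e ∣ e' ⟩ ⨾ ⟨ c₁ ∣ c₂ ⟩)) ⨾ ∼ P     ≡⟨ solve ·-monoid ⟩
          P ⨾ (∼ Q ⨾ ∼ R ⨾ ⟨ e ∣ e' ⟩) ⨾ ⟨ c₁ ∣ c₂ ⟩ ⨾ ∼ P       ≡⟨ cong (λ u → P ⨾ u ⨾ ⟨ c₁ ∣ c₂ ⟩ ⨾ ∼ P) guards-comm ⟩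
          P ⨾ (⟨ e ∣ e' ⟩ ⨾ (∼ Q ⨾ ∼ R)) ⨾ ⟨ c₁ ∣ c₂ ⟩ ⨾ ∼ P     ≡⟨ solve ·-monoid ⟩
          P ⨾ ⟨ e ∣ e' ⟩ ⨾ ∼ Q ⨾ ∼ R ⨾ ⟨ c₁ ∣ c₂ ⟩ ⨾ ∼ P         ≡⟨ both ⟩
          𝟘                                                      ∎
          where
            guards-comm : ∼ Q ⨾ ∼ R ⨾ ⟨ e ∣ e' ⟩ ≡ ⟨ e ∣ e' ⟩ ⨾ (∼ Q ⨾ ∼ R)
            guards-comm = Ä.𝔹-·-comm (Ä.𝔹-· (Ä.𝔹-¬ 𝔹Q) (Ä.𝔹-¬ 𝔹R)) (𝔹̈-⟨∣⟩ 𝔹e 𝔹e')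
        left-only-step : Invariant P (∼ Q ⨾ ⟨ e · c₁ ∣ ¬ e' ⟩)
        left-only-step = begin
          P ⨾ (∼ Q ⨾ ⟨ e · c₁ ∣ ¬ e' ⟩) ⨾ ∼ P                ≡⟨ cong (λ u → P ⨾ (∼ Q ⨾ u) ⨾ ∼ P) (⟨∣⟩-·ˡ e c₁ (¬ e')) ⟩
          P ⨾ (∼ Q ⨾ (⟨ e ∣ ¬ e' ⟩ ⨾ ⟨ c₁ ∣ 1# ⟩)) ⨾ ∼ P      ≡⟨ solve ·-monoid ⟩
          P ⨾ ((∼ Q ⨾ ⟨ e ∣ ¬ e' ⟩) ⨾ ⟨ c₁ ∣ 1# ⟩) ⨾ ∼ P      ≡⟨ ·-zero-prefix _ _ P·∼Q·⟨e∣¬e'⟩≡0 ⟩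
          𝟘                                                  ∎
        right-only-step : Invariant P (∼ R ⨾ ⟨ ¬ e ∣ e' · c₂ ⟩)
        right-only-step = begin
          P ⨾ (∼ R ⨾ ⟨ ¬ e ∣ e' · c₂ ⟩) ⨾ ∼ P                ≡⟨ cong (λ u → P ⨾ (∼ R ⨾ u) ⨾ ∼ P) (⟨∣⟩-·ʳ (¬ e) e' c₂) ⟩
          P ⨾ (∼ R ⨾ (⟨ ¬ e ∣ e' ⟩ ⨾ ⟨ 1# ∣ c₂ ⟩)) ⨾ ∼ P      ≡⟨ solve ·-monoid ⟩
          P ⨾ ((∼ R ⨾ ⟨ ¬ e ∣ e' ⟩) ⨾ ⟨ 1# ∣ c₂ ⟩) ⨾ ∼ P      ≡⟨ ·-zero-prefix _ _ P·∼R·⟨¬e∣e'⟩≡0 ⟩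
          𝟘                                                  ∎

    loopRule : StarIdentity D e e' c₁ c₂ Q R →
               (e · c₁) * · ¬ e ∣ (e' · c₂) * · ¬ e' ∶ P ≈> P ⨾ ⟨ ¬ e ∣ ¬ e' ⟩
    loopRule star = begin
      P ⨾ ⟨ (e · c₁) * · ¬ e ∣ (e' · c₂) * · ¬ e' ⟩ ⨾ ∼ (P ⨾ ⟨ ¬ e ∣ ¬ e' ⟩)
        ≡⟨ cong (λ u → P ⨾ u ⨾ ∼ (P ⨾ ⟨ ¬ e ∣ ¬ e' ⟩)) (trans (⟨∣⟩-*· (e · c₁) (¬ e) (e' · c₂) (¬ e')) star) ⟩
      P ⨾ (_ ⊛ ⨾ ⟨ ¬ e ∣ ¬ e' ⟩) ⨾ ∼ (P ⨾ ⟨ ¬ e ∣ ¬ e' ⟩)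
        ≡⟨ invariant-guard 𝔹P (𝔹̈-⟨∣⟩ (𝔹-¬ 𝔹e) (𝔹-¬ 𝔹e')) (invariant-* 𝔹P invariant-body) ⟩
      𝟘 ∎
      where open ≡-Reasoning

theorem6p2 :
  ∀ {ℓ : Level}
  -- (a): every *-continuous BiKAT satisfies (∗)
  → (∀ (𝔸 : KAT ℓ) (D : BiKAT 𝔸) → StarContinuousBiKAT D → SatisfiesStar D)
  -- (b): in every BiKAT satisfying (∗), the loop rule is sound
  × (∀ (𝔸 : KAT ℓ) (D : BiKAT 𝔸) → SatisfiesStar D →
      let open KAT 𝔸
          open BiKAT D
      in ∀ (e e' c₁ c₂ : Carrier) (P Q R : Ä-Carrier) →
         𝔹 e → 𝔹 e' → 𝔹̈ P → 𝔹̈ Q → 𝔹̈ R →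
         c₁ ∣ c₂ ∶ P ⨾ ⟨ e ∣ e' ⟩ ⨾ ∼ Q ⨾ ∼ R ≈> P →
         c₁ ∣ 1# ∶ P ⨾ Q ⨾ ⟨ e ] ≈> P →
         1# ∣ c₂ ∶ P ⨾ R ⨾ [ e' ⟩ ≈> P →
         P ≤̈ ⟨ e ∣ e' ⟩ ⊕ ⟨ ¬ e ∣ ¬ e' ⟩ ⊕ Q ⨾ ⟨ e ] ⊕ R ⨾ [ e' ⟩ →
         (e · c₁) * · ¬ e ∣ (e' · c₂) * · ¬ e' ∶ P ≈> P ⨾ ⟨ ¬ e ∣ ¬ e' ⟩)
theorem6p2 =
    -- only the *-continuity of Ä is needed, not that of 𝔸
    (λ 𝔸 D continuous → BiKATProperties.satisfiesStar D (proj₁ continuous))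
  , (λ 𝔸 D star e e' c₁ c₂ P Q R 𝔹e 𝔹e' 𝔹P 𝔹Q 𝔹R both left right P≤S →
       BiKATProperties.loopRule D 𝔹e 𝔹e' 𝔹P 𝔹Q 𝔹R both left right P≤S
         (star e e' c₁ c₂ Q R 𝔹e 𝔹e' 𝔹Q 𝔹R))
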